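{- Let $G$ be a biconnected cubic graph, and let $G_1'$, $v_0$ and $d_{max}$ be obtained from $G$ by the construction described in the context. Then $G_1'$ contains at least $d_{max}$ edges that are pairwise distinct, i.e. no two of them can be mapped to one another by a graph automorphism of $G_1'$.
   Context: All graphs are finite, simple (no loops, no multiple edges) and connected. A graph is cubic if every vertex has degree $3$. A bridge is an edge whose removal disconnects the graph; a bridge graph is a graph with at least one bridge. A graph is biconnected if it has no bridge but has some edge whose removal produces a graph with a bridge. In a biconnected graph, a bi-bridge is a set of two edges whose removal disconnects the graph. Two edges are called distinct if there is no graph automorphism mapping one edge to the other. An induced subgraph on a vertex set $S$ consists of $S$ and all edges with both endpoints in $S$. Construction. Let $G$ be a biconnected cubic graph. Among all bi-bridges of $G$, choose one whose removal splits the vertex set into two parts that are as equal in size as possible (ties broken arbitrarily). Removing it leaves two induced subgraphs; let $G_1$ be the one with more pairwise distinct edges lying in cycles, and $G_2$ the other. Write the bi-bridge as $\{x_1y_1, x_2y_2\}$ with $x_1,x_2\in G_2$ and $y_1,y_2\in G_1$, the four endpoints being distinct. Form $G'$ by deleting the edges $x_1y_1, x_2y_2$, adding four new vertices $p,q,r,s$, and adding the edges $px_1, px_2, pq, qr, qs, ry_1, sy_2$. Then $pq$ is a bridge of $G'$. Let $G_1'$ be the component of $G'$ with the edge $pq$ removed that contains $q$ (it consists of $G_1$ together with $q,r,s$ and the edges $qr,qs,ry_1,sy_2$). Set $v_0=q$, the vertex of $G_1'$ incident in $G'$ to the bridge, and let $d_{max}$ be the maximum, over all vertices $v$ of $G_1'$,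 of the distance in $G_1'$ from $v$ to $v_0$. -}

module Defs where

open import Data.Nat using (ℕ; zero; suc; _+_; _≤_; ∣_-_∣)
open import Data.Bool using (Bool; true; false; T; not; _∧_; _∨_; if_then_else_)
open import Data.Fin using (Fin; zero; suc; inject₁; fromℕ; _≟_)
open import Data.List using (List; map; allFin)
open import Data.Nat.ListAction using (sum)
open import Data.Product using (Σ; ∃; _×_; _,_; proj₁; proj₂)
open import Data.Sum using (_⊎_; inj₁; inj₂)
open import Data.Unit using (⊤)
open import Data.Empty using (⊥)
open import Relation.Nullary using (¬_)
open import Relation.Nullary.Decidable using (⌊_⌋)
open import Relation.Binary.PropositionalEquality using (_≡_; _≢_)
open import Relation.Binary.Construct.Closure.ReflexiveTransitive using (Star)
open import Function.Bundles using (_↔_; Inverse)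

record SimpleGraph (n : ℕ) : Set where
  field
    adj   : Fin n → Fin n → Bool
    sym   : ∀ u v → adj u v ≡ adj v u
    irrfl : ∀ v → adj v v ≡ false
open SimpleGraph public

count : {n : ℕ} → (Fin n → Bool) → ℕ
count {n} S = sum (map (λ v → if S v then 1 else 0) (allFin n))

degree : {n : ℕ} → SimpleGraph n → Fin n → ℕ
degree G v = count (adj G v)

Cubic : {n : ℕ} → SimpleGraph n → Set
Cubic G = ∀ v → degree G v ≡ 3

Reach : {n : ℕ} → (Fin n → Fin n → Bool) → Fin n → Fin n → Set
Reach a = Star (λ u v → T (a u v))

ConnectedAdj : {n : ℕ} → (Fin n → Fin n → Bool) → Set
ConnectedAdj {n} a = (u v : Fin n) → Reach a u v

DisconnectedAdj : {n : ℕ} → (Fin n → Fin n → Bool) → Set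
DisconnectedAdj {n} a = Σ (Fin n) λ u → Σ (Fin n) λ v → ¬ Reach a u v

Connected : {n : ℕ} → SimpleGraph n → Set
Connected G = ConnectedAdj (adj G)

samePair : {n : ℕ} → Fin n → Fin n → Fin n → Fin n → Bool
samePair u v a b = (⌊ u ≟ a ⌋ ∧ ⌊ v ≟ b ⌋) ∨ (⌊ u ≟ b ⌋ ∧ ⌊ v ≟ a ⌋)

delEdge : {n : ℕ} → (Fin n → Fin n → Bool) → Fin n → Fin n → (Fin n → Fin n → Bool)
delEdge a x y u v = a u v ∧ not (samePair u v x y)

IsBridgeAdj : {n : ℕ} → (Fin n → Fin n → Bool) → Fin n → Fin n → Set
IsBridgeAdj a x y = T (a x y) × DisconnectedAdj (delEdge a x y)

HasBridgeAdj : {n : ℕ} → (Fin n → Fin n → Bool) → Set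
HasBridgeAdj {n} a = Σ (Fin n) λ x → Σ (Fin n) λ y → IsBridgeAdj a x y

Biconnected : {n : ℕ} → SimpleGraph n → Set
Biconnected {n} G =
  ¬ HasBridgeAdj (adj G) ×
  (Σ (Fin n) λ x → Σ (Fin n) λ y →
     T (adj G x y) × HasBridgeAdj (delEdge (adj G) x y))

IsBiBridge : {n : ℕ} → SimpleGraph n → Fin n → Fin n → Fin n → Fin n → Set
IsBiBridge G a₁ b₁ a₂ b₂ =
  T (adj G a₁ b₁) × T (adj G a₂ b₂) × T (not (samePair a₁ b₁ a₂ b₂)) ×
  DisconnectedAdj (delEdge (delEdge (adj G) a₁ b₁) a₂ b₂)

IsSplit : {n : ℕ} → SimpleGraph n → Fin n → Fin n → Fin n → Fin n →
          (Fin n → Bool) → Set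
IsSplit {n} G a₁ b₁ a₂ b₂ S =
  (u v : Fin n) →
    (Reach (delEdge (delEdge (adj G) a₁ b₁) a₂ b₂) u v → S u ≡ S v) ×
    (S u ≡ S v → Reach (delEdge (delEdge (adj G) a₁ b₁) a₂ b₂) u v)

imbalance : {n : ℕ} → (Fin n → Bool) → ℕ
imbalance S = ∣ count S - count (λ v → not (S v)) ∣

-- General graphs (vertex type + adjacency relation), used for induced
-- subgraphs and for G₁'

record Graph : Set₁ where
  field
    V   : Set
    Adj : V → V → Set
open Graph public

toGraph : {n : ℕ} → SimpleGraph n → Graph
toGraph {n} G = record { V = Fin n ; Adj = λ u v → T (adj G u v) }

induced : {n : ℕ} → SimpleGraph n → (Fin n → Bool) → Graph
induced {n} G S = record
  { V = Σ (Fin n) (λ v → T (S v))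
  ; Adj = λ u v → T (adj G (proj₁ u) (proj₁ v)) }

-- edges as ordered representatives of unordered pairs
Edge : Graph → Set
Edge H = Σ (V H × V H) λ p → Adj H (proj₁ p) (proj₂ p)

IsAut : (H : Graph) → (V H ↔ V H) → Set
IsAut H σ = ∀ u v → (Adj H u v → Adj H (f u) (f v)) × (Adj H (f u) (f v) → Adj H u v)
  where f = Inverse.to σ

MapsEdge : (H : Graph) → (V H ↔ V H) → Edge H → Edge H → Set
MapsEdge H σ ((u , v) , _) ((a , b) , _) =
  (f u ≡ a × f v ≡ b) ⊎ (f u ≡ b × f v ≡ a)
  where f = Inverse.to σ

DistinctEdges : (H : Graph) → Edge H → Edge H → Set
DistinctEdges H e e' = ¬ (Σ (V H ↔ V H) λ σ → IsAut H σ × MapsEdge H σ e e')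

PairwiseDistinct : (H : Graph) → {k : ℕ} → (Fin k → Edge H) → Set
PairwiseDistinct H {k} e = (i j : Fin k) → i ≢ j → DistinctEdges H (e i) (e j)

HasDistinctEdges : Graph → ℕ → Set
HasDistinctEdges H k = Σ (Fin k → Edge H) λ e → PairwiseDistinct H e

-- cycles: c₀ c₁ … c_{m-1} (m = 3 + k) pairwise different vertices,
-- consecutive ones adjacent and c_{m-1} adjacent to c₀
record Cycle (H : Graph) : Set where
  field
    len  : ℕ
    vert : Fin (suc (suc (suc len))) → V H
    inj  : ∀ i j → vert i ≡ vert j → i ≡ j
    step : (i : Fin (suc (suc len))) → Adj H (vert (inject₁ i)) (vert (suc i))
    close : Adj H (vert (fromℕ (suc (suc len)))) (vert zero)

SamePair : {A : Set} → A → A → A → A → Set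
SamePair u v a b = (u ≡ a × v ≡ b) ⊎ (u ≡ b × v ≡ a)

OnCycle : (H : Graph) → Cycle H → Edge H → Set
OnCycle H C ((u , v) , _) =
  (Σ (Fin (suc (suc (Cycle.len C)))) λ i →
     SamePair u v (Cycle.vert C (inject₁ i)) (Cycle.vert C (suc i)))
  ⊎ SamePair u v (Cycle.vert C (fromℕ (suc (suc (Cycle.len C))))) (Cycle.vert C zero)

LiesInCycle : (H : Graph) → Edge H → Set
LiesInCycle H e = Σ (Cycle H) λ C → OnCycle H C e

HasDistinctCycleEdges : Graph → ℕ → Set
HasDistinctCycleEdges H k =
  Σ (Fin k → Edge H) λ e → PairwiseDistinct H e × ((i : Fin k) → LiesInCycle H (e i))

data New : Set where
  q r s : New

G1'Adj : {n : ℕ} → SimpleGraph n → (S₁ : Fin n → Bool) → Fin n → Fin n →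
         (Σ (Fin n) (λ v → T (S₁ v)) ⊎ New) → (Σ (Fin n) (λ v → T (S₁ v)) ⊎ New) → Set
G1'Adj G S₁ y₁ y₂ (inj₁ a) (inj₁ b) = T (adj G (proj₁ a) (proj₁ b))
G1'Adj G S₁ y₁ y₂ (inj₂ q) (inj₂ r) = ⊤
G1'Adj G S₁ y₁ y₂ (inj₂ r) (inj₂ q) = ⊤
G1'Adj G S₁ y₁ y₂ (inj₂ q) (inj₂ s) = ⊤
G1'Adj G S₁ y₁ y₂ (inj₂ s) (inj₂ q) = ⊤
G1'Adj G S₁ y₁ y₂ (inj₂ r) (inj₁ b) = proj₁ b ≡ y₁
G1'Adj G S₁ y₁ y₂ (inj₁ a) (inj₂ r) = proj₁ a ≡ y₁
G1'Adj G S₁ y₁ y₂ (inj₂ s) (inj₁ b) = proj₁ b ≡ y₂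
G1'Adj G S₁ y₁ y₂ (inj₁ a) (inj₂ s) = proj₁ a ≡ y₂
G1'Adj G S₁ y₁ y₂ _ _ = ⊥

G1' : {n : ℕ} → SimpleGraph n → (Fin n → Bool) → Fin n → Fin n → Graph
G1' {n} G S₁ y₁ y₂ = record
  { V = Σ (Fin n) (λ v → T (S₁ v)) ⊎ New
  ; Adj = G1'Adj G S₁ y₁ y₂ }

data Walk (H : Graph) : V H → V H → ℕ → Set where
  []  : ∀ {u} → Walk H u u 0
  _∷_ : ∀ {u v w k} → Adj H u v → Walk H v w k → Walk H u w (suc k)

Dist : (H : Graph) → V H → V H → ℕ → Set
Dist H u v d = Walk H u v d × (∀ k → Walk H u v k → d ≤ k)

IsMaxDist : (H : Graph) → V H → ℕ → Set
IsMaxDist H v₀ d =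
  (Σ (V H) λ v → Dist H v v₀ d) × (∀ v d' → Dist H v v₀ d' → d' ≤ d)

-- Every automorphism of G₁' fixes q: in a cubic graph the vertices of G₁
-- keep degree 3 in G₁' (the bi-bridge edges at y₁, y₂ are replaced by the
-- edges to r, s), so q is the only vertex of degree at most 2 all of whose
-- neighbours also have degree at most 2. Automorphisms fixing q preserve the
-- distance to q, hence along a shortest path from a vertex at distance d_max
-- down to q the d_max edges lie on pairwise different distance levels, and no
-- automorphism can map one of them to another.
module Submission where

open import Defs hiding (sym)
open import Data.Bool using (Bool; true; false; T; not; _∧_; if_then_else_)
open import Data.Bool.Properties using (T-∧; T-∨; T-irrelevant)
open import Data.Empty using (⊥-elim)
open import Data.Fin using (Fin; zero; suc; toℕ; _≟_)
open import Data.Fin.Properties using (0≢1+n; toℕ-injective; toℕ<n)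
import Data.Fin.Properties as Fin
open import Data.List using (tabulate)
open import Data.List.Properties using (map-tabulate)
open import Data.Nat using (ℕ; zero; suc; _+_; _≤_; _<_; z≤n; s≤s)
open import Data.Nat.ListAction using (sum)
open import Data.Nat.Properties
  using (≤-refl; ≤-reflexive; ≤-trans; ≤-antisym; +-mono-≤; ≤-pred; <-asym; m<1+n⇒m<n∨m≡n; suc-injective;
         +-commutativeSemigroup)
open import Algebra.Properties.CommutativeSemigroup +-commutativeSemigroup using (interchange)
open import Data.Product using (Σ; _×_; _,_; proj₁; proj₂)
open import Data.Sum using (_⊎_; inj₁; inj₂)
import Data.Sum as Sum
open import Data.Unit using (tt)
open import Function using (_∘_; case_of_)
open import Function.Bundles using (_↔_; Inverse; Equivalence)
open import Relation.Nullary using (¬_)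
open import Relation.Nullary.Decidable using (⌊_⌋; toWitness; fromWitness)
open import Relation.Binary.PropositionalEquality
  using (_≡_; _≢_; refl; sym; trans; cong; subst; subst₂)
open import Relation.Binary.Construct.Closure.ReflexiveTransitive using (ε; _◅_)

private
  variable
    n : ℕ

count-tabulate : (S : Fin n → Bool) → count S ≡ sum (tabulate (λ v → if S v then 1 else 0))
count-tabulate S = cong sum (map-tabulate (λ v → v) (λ v → if S v then 1 else 0))

count-suc : (S : Fin (suc n) → Bool) → count S ≡ (if S zero then 1 else 0) + count (S ∘ suc)
count-suc S =
  trans (count-tabulate S) (cong ((if S zero then 1 else 0) +_) (sym (count-tabulate (S ∘ suc))))

count-none : (S : Fin n → Bool) → (∀ v → ¬ T (S v)) → count S ≡ 0
count-none {zero} S none = refl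
count-none {suc n} S none rewrite count-suc S with S zero in S₀
... | true = ⊥-elim (none zero (subst T (sym S₀) tt))
... | false = count-none (S ∘ suc) (none ∘ suc)

count-≤1 : (S : Fin n → Bool) → (∀ u v → T (S u) → T (S v) → u ≡ v) → count S ≤ 1
count-≤1 {zero} S unique = z≤n
count-≤1 {suc n} S unique rewrite count-suc S with S zero in S₀
... | true = ≤-reflexive (cong suc (count-none (S ∘ suc)
               λ v Sv → 0≢1+n (unique zero (suc v) (subst T (sym S₀) tt) Sv)))
... | false = count-≤1 (S ∘ suc) (λ u v Su Sv → Fin.suc-injective (unique (suc u) (suc v) Su Sv))

count-subadditive : (S S₁ S₂ : Fin n → Bool) → (∀ v → T (S v) → T (S₁ v) ⊎ T (S₂ v)) →
  count S ≤ count S₁ + count S₂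
count-subadditive {zero} S S₁ S₂ cover = z≤n
count-subadditive {suc n} S S₁ S₂ cover
  rewrite count-suc S | count-suc S₁ | count-suc S₂
        | interchange (if S₁ zero then 1 else 0) (count (S₁ ∘ suc)) (if S₂ zero then 1 else 0) (count (S₂ ∘ suc))
  = +-mono-≤ (head-≤ (cover zero)) (count-subadditive (S ∘ suc) (S₁ ∘ suc) (S₂ ∘ suc) (cover ∘ suc))
  where
  head-≤ : ∀ {a b c} → (T a → T b ⊎ T c) → (if a then 1 else 0) ≤ (if b then 1 else 0) + (if c then 1 else 0)
  head-≤ {false} _ = z≤n
  head-≤ {true} {true} _ = s≤s z≤n
  head-≤ {true} {false} {true} _ = ≤-refl
  head-≤ {true} {false} {false} cover₀ with cover₀ tt
  ... | inj₁ ()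
  ... | inj₂ ()

count-⊆-pair : (S : Fin n → Bool) (c d : Fin n) → (∀ u → T (S u) → u ≡ c ⊎ u ≡ d) → count S ≤ 2
count-⊆-pair S c d cover = ≤-trans
  (count-subadditive S (is c) (is d) (λ v → Sum.map fromWitness fromWitness ∘ cover v))
  (+-mono-≤ (count-≤1 (is c) (is-unique c)) (count-≤1 (is d) (is-unique d)))
  where
  is : Fin _ → Fin _ → Bool
  is c v = ⌊ v ≟ c ⌋
  is-unique : ∀ c u v → T (is c u) → T (is c v) → u ≡ v
  is-unique c u v u≡c v≡c = trans (toWitness u≡c) (sym (toWitness v≡c))

T-samePair : {u v a b : Fin n} → T (samePair u v a b) → SamePair u v a b
T-samePair = Sum.map both both ∘ Equivalence.to T-∨
  where
  both : ∀ {u v a b : Fin _} → T (⌊ u ≟ a ⌋ ∧ ⌊ v ≟ b ⌋) → u ≡ a × v ≡ b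
  both {u} {v} {a} {b} p =
    let (p₁ , p₂) = Equivalence.to (T-∧ {⌊ u ≟ a ⌋} {⌊ v ≟ b ⌋}) p in toWitness p₁ , toWitness p₂

T-not-T : ∀ {b} → T b → ¬ T (not b)
T-not-T {true} _ ()

T-∧-not : ∀ {a b} → T a → b ≡ false → T (a ∧ not b)
T-∧-not {true} _ refl = tt

crossing-edge : (G : SimpleGraph n) {a₁ b₁ a₂ b₂ : Fin n} {S : Fin n → Bool} →
  IsSplit G a₁ b₁ a₂ b₂ S → {u v : Fin n} → T (adj G u v) → S u ≢ S v →
  SamePair u v a₁ b₁ ⊎ SamePair u v a₂ b₂
crossing-edge G {a₁} {b₁} {a₂} {b₂} split {u} {v} uv Su≢Sv
  with samePair u v a₁ b₁ in e₁ | samePair u v a₂ b₂ in e₂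
... | true | _ = inj₁ (T-samePair (subst T (sym e₁) tt))
... | false | true = inj₂ (T-samePair (subst T (sym e₂) tt))
... | false | false = ⊥-elim (Su≢Sv (proj₁ (split u v) (T-∧-not (T-∧-not uv e₁) e₂ ◅ ε)))

AtMostTwoNeighbours : (H : Graph) → V H → Set
AtMostTwoNeighbours H w = Σ (V H) λ a → Σ (V H) λ b → ∀ c → Adj H w c → c ≡ a ⊎ c ≡ b

LowNeighbourhood : (H : Graph) → V H → Set
LowNeighbourhood H w = AtMostTwoNeighbours H w × (∀ c → Adj H w c → AtMostTwoNeighbours H c)

mapWalk : (H : Graph) (f : V H → V H) → (∀ u v → Adj H u v → Adj H (f u) (f v)) →
  ∀ {u w k} → Walk H u w k → Walk H (f u) (f w) k
mapWalk H f f-adj [] = []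
mapWalk H f f-adj (e ∷ W) = f-adj _ _ e ∷ mapWalk H f f-adj W

Dist-unique : (H : Graph) {u t : V H} {d d' : ℕ} → Dist H u t d → Dist H u t d' → d ≡ d'
Dist-unique H (W , minimal) (W' , minimal') = ≤-antisym (minimal _ W') (minimal' _ W)

module Automorphism (H : Graph) (σ : V H ↔ V H) (aut : IsAut H σ) where
  open Inverse σ using (to; from; strictlyInverseˡ; strictlyInverseʳ)

  to-Adj : ∀ u v → Adj H u v → Adj H (to u) (to v)
  to-Adj u v = proj₁ (aut u v)

  from-Adj : ∀ u v → Adj H u v → Adj H (from u) (from v)
  from-Adj u v uv = proj₂ (aut (from u) (from v))
    (subst₂ (Adj H) (sym (strictlyInverseˡ u)) (sym (strictlyInverseˡ v)) uv)

  from-Adj-to : ∀ w c → Adj H (to w) c → Adj H w (from c)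
  from-Adj-to w c e = subst (λ z → Adj H z (from c)) (strictlyInverseʳ w) (from-Adj (to w) c e)

  AtMostTwoNeighbours-to : ∀ w → AtMostTwoNeighbours H w → AtMostTwoNeighbours H (to w)
  AtMostTwoNeighbours-to w (a , b , nbrs) = to a , to b , λ c e →
    Sum.map (back c) (back c) (nbrs (from c) (from-Adj-to w c e))
    where
    back : ∀ c {x} → from c ≡ x → c ≡ to x
    back c refl = sym (strictlyInverseˡ c)

  LowNeighbourhood-to : ∀ w → LowNeighbourhood H w → LowNeighbourhood H (to w)
  LowNeighbourhood-to w (low , nbrs-low) = AtMostTwoNeighbours-to w low , λ c e →
    subst (AtMostTwoNeighbours H) (strictlyInverseˡ c)
      (AtMostTwoNeighbours-to (from c) (nbrs-low (from c) (from-Adj-to w c e)))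

  Dist-to : ∀ {t} → to t ≡ t → ∀ {u d} → Dist H u t d → Dist H (to u) t d
  Dist-to {t} fixed {u} {d} (W , minimal) =
    subst (λ z → Walk H (to u) z d) fixed (mapWalk H to to-Adj W) ,
    λ k W' → minimal k
      (subst₂ (λ a b → Walk H a b k) (strictlyInverseʳ u) from-t≡t (mapWalk H from from-Adj W'))
    where
    from-t≡t : from t ≡ t
    from-t≡t = trans (cong from (sym fixed)) (strictlyInverseʳ t)

Dist-tail : (H : Graph) {u v t : V H} {m : ℕ} (e : Adj H u v) (W : Walk H v t m) →
  Dist H u t (suc m) → Dist H v t m
Dist-tail H e W (_ , minimal) = W , λ k W' → ≤-pred (minimal (suc k) (e ∷ W'))

LevelEdge : (H : Graph) → V H → ℕ → Set
LevelEdge H t k = Σ (Edge H) λ e → Dist H (proj₁ (proj₁ e)) t (suc k) × Dist H (proj₂ (proj₁ e)) t k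

levelEdge : (H : Graph) {u t : V H} {m : ℕ} → Dist H u t m → ∀ {k} → k < m → LevelEdge H t k
levelEdge H D@(e ∷ W , _) k<1+m with m<1+n⇒m<n∨m≡n k<1+m
... | inj₁ k<m = levelEdge H (Dist-tail H e W D) k<m
... | inj₂ refl = (_ , e) , D , Dist-tail H e W D

fixed⇒distinctEdges : (H : Graph) (t : V H) → (∀ σ → IsAut H σ → Inverse.to σ t ≡ t) →
  ∀ {u d} → Dist H u t d → HasDistinctEdges H d
fixed⇒distinctEdges H t fixed D = edge , distinct
  where
  edge : Fin _ → Edge H
  edge i = proj₁ (levelEdge H D (toℕ<n i))

  distinct : PairwiseDistinct H edge
  distinct i j i≢j (σ , aut , maps)
    with levelEdge H D (toℕ<n i) | levelEdge H D (toℕ<n j)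
  ... | ((a , b) , _) , Da , Db | ((a' , b') , _) , Da' , Db' = case maps of λ where
      (inj₁ (σa≡a' , _)) → i≢j (toℕ-injective (suc-injective (Dist-unique H (moved σa≡a' Da) Da')))
      (inj₂ (σa≡b' , σb≡a')) → <-asym
        (≤-reflexive (Dist-unique H (moved σa≡b' Da) Db'))
        (≤-reflexive (sym (Dist-unique H (moved σb≡a' Db) Da')))
    where
    open Automorphism H σ aut
    moved : ∀ {x y k} → Inverse.to σ x ≡ y → Dist H x t k → Dist H y t k
    moved refl = Dist-to (fixed σ aut)

module G₁'-bridgeEnd {n} (G : SimpleGraph n) (cubic : Cubic G)
  {x₁ y₁ x₂ y₂ : Fin n} {S₁ : Fin n → Bool}
  (split : IsSplit G x₁ y₁ x₂ y₂ S₁)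
  (y₁∈S₁ : T (S₁ y₁)) (y₂∈S₁ : T (S₁ y₂)) (x₁∉S₁ : T (not (S₁ x₁))) (x₂∉S₁ : T (not (S₁ x₂))) where

  H : Graph
  H = G1' G S₁ y₁ y₂

  leaving-S₁ : ∀ {v u} → T (S₁ v) → T (adj G v u) → S₁ u ≡ false → (v ≡ y₁ × u ≡ x₁) ⊎ (v ≡ y₂ × u ≡ x₂)
  leaving-S₁ v∈ vu u∉ with crossing-edge G split vu (λ Sv≡Su → subst T (trans Sv≡Su u∉) v∈)
  ... | inj₁ (inj₁ (refl , _)) = ⊥-elim (T-not-T v∈ x₁∉S₁)
  ... | inj₁ (inj₂ edge) = inj₁ edge
  ... | inj₂ (inj₁ (refl , _)) = ⊥-elim (T-not-T v∈ x₂∉S₁)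
  ... | inj₂ (inj₂ edge) = inj₂ edge

  -- q is never a neighbour of a vertex of G₁, so its image is irrelevant.
  toG : V H → Fin n
  toG (inj₁ v) = proj₁ v
  toG (inj₂ q) = x₁
  toG (inj₂ r) = x₁
  toG (inj₂ s) = x₂

  G₁-vertex-¬AtMostTwoNeighbours : ∀ v (v∈ : T (S₁ v)) → ¬ AtMostTwoNeighbours H (inj₁ (v , v∈))
  G₁-vertex-¬AtMostTwoNeighbours v v∈ (a , b , nbrs) =
    3≰2 (subst (_≤ 2) (cubic v) (count-⊆-pair (adj G v) (toG a) (toG b) nbrsG))
    where
    3≰2 : ¬ 3 ≤ 2
    3≰2 (s≤s (s≤s ()))
    nbrsG : ∀ u → T (adj G v u) → u ≡ toG a ⊎ u ≡ toG b
    nbrsG u vu with S₁ u in u∈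
    ... | true = Sum.map (cong toG) (cong toG) (nbrs (inj₁ (u , subst T (sym u∈) tt)) vu)
    ... | false with leaving-S₁ v∈ vu u∈
    ... | inj₁ (refl , refl) = Sum.map (cong toG) (cong toG) (nbrs (inj₂ r) refl)
    ... | inj₂ (refl , refl) = Sum.map (cong toG) (cong toG) (nbrs (inj₂ s) refl)

  LowNeighbourhood⇒q : ∀ w → LowNeighbourhood H w → w ≡ inj₂ q
  LowNeighbourhood⇒q (inj₁ (v , v∈)) (low , _) = ⊥-elim (G₁-vertex-¬AtMostTwoNeighbours v v∈ low)
  LowNeighbourhood⇒q (inj₂ q) _ = refl
  LowNeighbourhood⇒q (inj₂ r) (_ , nbrs-low) =
    ⊥-elim (G₁-vertex-¬AtMostTwoNeighbours y₁ y₁∈S₁ (nbrs-low (inj₁ (y₁ , y₁∈S₁)) refl))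
  LowNeighbourhood⇒q (inj₂ s) (_ , nbrs-low) =
    ⊥-elim (G₁-vertex-¬AtMostTwoNeighbours y₂ y₂∈S₁ (nbrs-low (inj₁ (y₂ , y₂∈S₁)) refl))

  G₁-vertex-≡ : ∀ {u y} (y∈ : T (S₁ y)) → u ≡ y → (u∈ : T (S₁ u)) →
    _≡_ {A = V H} (inj₁ (u , u∈)) (inj₁ (y , y∈))
  G₁-vertex-≡ y∈ refl u∈ = cong (λ p → inj₁ (_ , p)) (T-irrelevant u∈ y∈)

  LowNeighbourhood-q : LowNeighbourhood H (inj₂ q)
  LowNeighbourhood-q = (inj₂ r , inj₂ s , nbrs-q) , nbrs-low
    where
    nbrs-q : ∀ c → Adj H (inj₂ q) c → c ≡ inj₂ r ⊎ c ≡ inj₂ s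
    nbrs-q (inj₂ r) _ = inj₁ refl
    nbrs-q (inj₂ s) _ = inj₂ refl
    nbrs-low : ∀ c → Adj H (inj₂ q) c → AtMostTwoNeighbours H c
    nbrs-low (inj₂ r) _ = inj₂ q , inj₁ (y₁ , y₁∈S₁) , λ where
      (inj₂ q) _ → inj₁ refl
      (inj₁ (u , u∈)) u≡y₁ → inj₂ (G₁-vertex-≡ y₁∈S₁ u≡y₁ u∈)
    nbrs-low (inj₂ s) _ = inj₂ q , inj₁ (y₂ , y₂∈S₁) , λ where
      (inj₂ q) _ → inj₁ refl
      (inj₁ (u , u∈)) u≡y₂ → inj₂ (G₁-vertex-≡ y₂∈S₁ u≡y₂ u∈)

  automorphism-fixes-q : ∀ σ → IsAut H σ → Inverse.to σ (inj₂ q) ≡ inj₂ q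
  automorphism-fixes-q σ aut =
    LowNeighbourhood⇒q _ (Automorphism.LowNeighbourhood-to H σ aut (inj₂ q) LowNeighbourhood-q)

lemma4p1 : (n : ℕ) (G : SimpleGraph n) → Connected G → Cubic G → Biconnected G →
    (x₁ y₁ x₂ y₂ : Fin n) (S₁ : Fin n → Bool) →
    IsBiBridge G x₁ y₁ x₂ y₂ → IsSplit G x₁ y₁ x₂ y₂ S₁ →
    T (S₁ y₁) → T (S₁ y₂) → T (not (S₁ x₁)) → T (not (S₁ x₂)) →
    ((a₁ b₁ a₂ b₂ : Fin n) (S : Fin n → Bool) →
      IsBiBridge G a₁ b₁ a₂ b₂ → IsSplit G a₁ b₁ a₂ b₂ S →
      imbalance S₁ ≤ imbalance S) →
    ((k : ℕ) → HasDistinctCycleEdges (induced G (λ v → not (S₁ v))) k →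
      HasDistinctCycleEdges (induced G S₁) k) →
    (dmax : ℕ) → IsMaxDist (G1' G S₁ y₁ y₂) (inj₂ q) dmax →
    HasDistinctEdges (G1' G S₁ y₁ y₂) dmax
lemma4p1 n G _ cubic _ x₁ y₁ x₂ y₂ S₁ _ split y₁∈S₁ y₂∈S₁ x₁∉S₁ x₂∉S₁ _ _ dmax ((_ , farthest) , _) =
  fixed⇒distinctEdges (G1' G S₁ y₁ y₂) (inj₂ q)
    (G₁'-bridgeEnd.automorphism-fixes-q G cubic split y₁∈S₁ y₂∈S₁ x₁∉S₁ x₂∉S₁) farthest
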